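{- Let $s\in\mathbb N$ and let $\lambda$ be an $s$-monotone mancala configuration. Then $\Phi(\lambda)$ is $s$-monotone.
   Context: A mancala configuration is a map $\lambda:\mathbb N^*\to\mathbb N$ whose support $\{i:\lambda_i>0\}$ equals $\{1,\dots,\ell(\lambda)\}$ for some $\ell(\lambda)\ge0$. The move $\Phi$: $\mu=\Phi(\lambda)$ with $\mu_i=\lambda_{i+1}+1$ for $1\le i\le\lambda_1$, $\mu_i=\lambda_{i+1}$ for $i>\lambda_1$. The energy sequence $e=e(\lambda):\mathbb Z\to\mathbb N$ of a nonzero $\lambda$: with $m=\max\{\lambda_1,\ell(\lambda)\}$, set $e_i=\lambda_i+i-1$ for $i=1,\dots,m$ and extend $e$ to $\mathbb Z$ periodically with period $m$. For $s\ge1$, $\lambda$ is $s$-monotone if (i) $\lambda_1\le\ell(\lambda)+1$ and (ii) $e_j\le e_i+1$ for all integers $i<j\le i+s$. Every mancala configuration is by convention $0$-monotone. -}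

module Defs where

open import Data.Nat using (ℕ; zero; suc; _+_; _∸_; _⊔_; _≤_; _<_; NonZero)
open import Data.Nat.Properties using (_<?_)
open import Data.Integer as ℤ using (ℤ; +_)
open import Data.Integer.DivMod using (_%ℕ_)
open import Data.Product using (Σ; _×_)
open import Relation.Nullary using (does)
open import Data.Bool using (if_then_else_)
open import Relation.Binary.PropositionalEquality using (_≡_)

-- Convention: a map λ : ℕ* → ℕ is encoded as  f : ℕ → ℕ  with
--   f i = λ_(i+1)   (0-indexed positions).

HasLength : (ℕ → ℕ) → ℕ → Set
HasLength f ℓ = ∀ i → (0 < f i → i < ℓ) × (i < ℓ → 0 < f i)

IsConfig : (ℕ → ℕ) → Set
IsConfig f = Σ ℕ (HasLength f)

-- The move Φ:  μ_i = λ_(i+1) + 1  for 1 ≤ i ≤ λ_1,  μ_i = λ_(i+1) otherwise.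
-- 0-indexed: (Φ f) i = f (i+1) + [i < f 0].
Φ : (ℕ → ℕ) → (ℕ → ℕ)
Φ f i = if does (i <? f 0) then suc (f (suc i)) else f (suc i)

-- Energy sequence of a nonzero configuration with ℓ = suc ℓ'.
-- Period m = max(λ_1, ℓ) = suc ((f 0 ∸ 1) ⊔ ℓ')  (equal since ℓ ≥ 1).
period : (ℕ → ℕ) → ℕ → ℕ
period f ℓ' = suc ((f 0 ∸ 1) ⊔ ℓ')

-- e_k for k ∈ ℤ: with r = k mod m ∈ {0..m-1} (paper index r+1),
-- e = λ_(r+1) + (r+1) - 1 = f r + r.
energy : (ℕ → ℕ) → ℕ → ℤ → ℕ
energy f ℓ' k = f r + r
  where r = k %ℕ period f ℓ'

-- s-monotone (s ≥ 1): (i) λ_1 ≤ ℓ+1 and (ii) e_j ≤ e_i + 1 for all integers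
-- i < j ≤ i + s (written j = i + d with 1 ≤ d ≤ s); (ii) only concerns
-- nonzero configurations, where e is defined.
MonotoneCond : ℕ → (ℕ → ℕ) → ℕ → Set
MonotoneCond s f ℓ =
  (f 0 ≤ ℓ + 1) ×
  (∀ ℓ' → ℓ ≡ suc ℓ' →
     ∀ (i : ℤ) (d : ℕ) → 1 ≤ d → d ≤ s →
       energy f ℓ' (i ℤ.+ + d) ≤ energy f ℓ' i + 1)

-- Every configuration is 0-monotone.
Monotone : ℕ → (ℕ → ℕ) → Set
Monotone zero    f = IsConfig f
Monotone (suc s) f = Σ ℕ λ ℓ → HasLength f ℓ × MonotoneCond (suc s) f ℓ

-- Condition (ii) only concerns the energies e₁ … e_m of one period, read cyclically: a
-- forward step of length at most s, possibly wrapping past e_m, raises the energy by at most 1.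
-- After the move the energy at position i is e_{i+1} for i ≤ λ₁ and e_{i+1} − 1 beyond.
-- So the new cyclic sequence is either e₂, …, e_m followed by one or two copies of e₁ = λ₁
-- (when λ₁ ≥ ℓ, or λ₂ = λ₁ = ℓ − 1), or, when the period drops by one, e₂, …, e_m with 1
-- subtracted after position λ₁; there the wrap-around steps are controlled by eᵢ ≥ i.
-- Both operations preserve the cyclic condition.

module Submission where

open import Defs
open import Data.Nat
  using (ℕ; zero; suc; _+_; _∸_; _⊔_; _≤_; _<_; NonZero; pred; s≤s; s≤s⁻¹; z≤n; _≤?_; _<?_)
open import Data.Nat.Properties
open import Data.Nat.DivMod
open import Data.Integer as ℤ using (ℤ; +_; -[1+_])
open import Data.Integer.DivMod using (_%ℕ_; n%ℕd<d)
import Data.Integer.Properties as ℤ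
open import Data.Bool using (if_then_else_)
open import Data.Sum using (inj₁; inj₂)
open import Data.Product using (_,_; proj₁; proj₂)
open import Relation.Nullary using (yes; no; contradiction)
open import Relation.Nullary.Decidable using (dec-true; dec-false)
open import Relation.Binary.PropositionalEquality

[1+m%n]%n≡[1+m]%n : ∀ m n .{{_ : NonZero n}} → suc (m % n) % n ≡ suc m % n
[1+m%n]%n≡[1+m]%n m n = begin
  suc (m % n) % n             ≡⟨ %-distribˡ-+ 1 (m % n) n ⟩
  (1 % n + m % n % n) % n     ≡⟨ cong (λ z → (1 % n + z) % n) (m%n%n≡m%n m n) ⟩
  (1 % n + m % n) % n         ≡⟨ %-distribˡ-+ 1 m n ⟨
  suc m % n                   ∎
  where open ≡-Reasoning

-[1+m]%ℕn≡[n∸[1+m]%n]%n : ∀ m n .{{_ : NonZero n}} → -[1+ m ] %ℕ n ≡ (n ∸ suc m % n) % n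
-[1+m]%ℕn≡[n∸[1+m]%n]%n m n@(suc n-1) with suc m % n
... | zero  = sym (n%n≡0 n)
... | suc r = sym (m<n⇒m%n≡m (s≤s (m∸n≤m n-1 r)))


[n∸r]%n≡[1+[n∸[1+r]%n]]%n : ∀ {r n} .{{_ : NonZero n}} → r < n → (n ∸ r) % n ≡ suc (n ∸ suc r % n) % n
[n∸r]%n≡[1+[n∸[1+r]%n]]%n {r} {n} r<n with m≤n⇒m<n∨m≡n r<n
... | inj₁ 1+r<n = cong (_% n) (begin
  n ∸ r               ≡⟨ +-∸-assoc 1 (<⇒≤ 1+r<n) ⟩
  suc (n ∸ suc r)     ≡⟨ cong (λ k → suc (n ∸ k)) (m<n⇒m%n≡m 1+r<n) ⟨
  suc (n ∸ suc r % n) ∎)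
  where open ≡-Reasoning
... | inj₂ refl = begin
  (suc r ∸ r) % n  ≡⟨ cong (_% n) (m+n∸n≡m 1 r) ⟩
  1 % n            ≡⟨ [m+n]%n≡m%n 1 n ⟨
  suc n % n        ≡⟨ cong (λ k → suc (n ∸ k) % n) (n%n≡0 n) ⟨
  suc (n ∸ n % n) % n ∎
  where open ≡-Reasoning


[n∸k%n]%n≡[1+[n∸[1+k]%n]%n]%n : ∀ k n .{{_ : NonZero n}} →
  (n ∸ k % n) % n ≡ suc ((n ∸ suc k % n) % n) % n
[n∸k%n]%n≡[1+[n∸[1+k]%n]%n]%n k n = begin
  (n ∸ k % n) % n               ≡⟨ [n∸r]%n≡[1+[n∸[1+r]%n]]%n (m%n<n k n) ⟩
  suc (n ∸ suc (k % n) % n) % n ≡⟨ cong (λ j → suc (n ∸ j) % n) ([1+m%n]%n≡[1+m]%n k n) ⟩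
  suc (n ∸ suc k % n) % n       ≡⟨ [1+m%n]%n≡[1+m]%n (n ∸ suc k % n) n ⟨
  suc ((n ∸ suc k % n) % n) % n ∎
  where open ≡-Reasoning

[1+i]%ℕn≡[1+i%ℕn]%n : ∀ i n .{{_ : NonZero n}} → ℤ.suc i %ℕ n ≡ suc (i %ℕ n) % n
[1+i]%ℕn≡[1+i%ℕn]%n (+ m) n = sym ([1+m%n]%n≡[1+m]%n m n)
[1+i]%ℕn≡[1+i%ℕn]%n -[1+ 0 ] n@(suc _) = begin
  0                            ≡⟨ n%n≡0 n ⟨
  (n ∸ 0 % n) % n              ≡⟨ [n∸k%n]%n≡[1+[n∸[1+k]%n]%n]%n 0 n ⟩
  suc ((n ∸ 1 % n) % n) % n    ≡⟨ cong (λ j → suc j % n) (-[1+m]%ℕn≡[n∸[1+m]%n]%n 0 n) ⟨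
  suc (-[1+ 0 ] %ℕ n) % n      ∎
  where open ≡-Reasoning
[1+i]%ℕn≡[1+i%ℕn]%n -[1+ suc m ] n = begin
  -[1+ m ] %ℕ n                    ≡⟨ -[1+m]%ℕn≡[n∸[1+m]%n]%n m n ⟩
  (n ∸ suc m % n) % n              ≡⟨ [n∸k%n]%n≡[1+[n∸[1+k]%n]%n]%n (suc m) n ⟩
  suc ((n ∸ suc (suc m) % n) % n) % n ≡⟨ cong (λ j → suc j % n) (-[1+m]%ℕn≡[n∸[1+m]%n]%n (suc m) n) ⟨
  suc (-[1+ suc m ] %ℕ n) % n      ∎
  where open ≡-Reasoning

[i+d]%ℕn≡[i%ℕn+d]%n : ∀ i d n .{{_ : NonZero n}} → (i ℤ.+ + d) %ℕ n ≡ (i %ℕ n + d) % n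
[i+d]%ℕn≡[i%ℕn+d]%n i zero n = begin
  (i ℤ.+ + 0) %ℕ n   ≡⟨ cong (_%ℕ n) (ℤ.+-identityʳ i) ⟩
  i %ℕ n             ≡⟨ m<n⇒m%n≡m (n%ℕd<d i n) ⟨
  i %ℕ n % n         ≡⟨ cong (_% n) (+-identityʳ (i %ℕ n)) ⟨
  (i %ℕ n + 0) % n   ∎
  where open ≡-Reasoning
[i+d]%ℕn≡[i%ℕn+d]%n i (suc d) n = begin
  (i ℤ.+ + suc d) %ℕ n          ≡⟨ cong (_%ℕ n) (ℤ.+-assoc i (+ 1) (+ d)) ⟨
  ((i ℤ.+ + 1) ℤ.+ + d) %ℕ n    ≡⟨ cong (λ j → (j ℤ.+ + d) %ℕ n) (ℤ.+-comm i (+ 1)) ⟩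
  ((+ 1 ℤ.+ i) ℤ.+ + d) %ℕ n    ≡⟨ cong (_%ℕ n) (ℤ.+-assoc (+ 1) i (+ d)) ⟩
  ℤ.suc (i ℤ.+ + d) %ℕ n        ≡⟨ [1+i]%ℕn≡[1+i%ℕn]%n (i ℤ.+ + d) n ⟩
  suc ((i ℤ.+ + d) %ℕ n) % n    ≡⟨ cong (λ j → suc j % n) ([i+d]%ℕn≡[i%ℕn+d]%n i d n) ⟩
  suc ((i %ℕ n + d) % n) % n    ≡⟨ [1+m%n]%n≡[1+m]%n (i %ℕ n + d) n ⟩
  suc (i %ℕ n + d) % n          ≡⟨ cong (_% n) (+-suc (i %ℕ n) d) ⟨
  (i %ℕ n + suc d) % n          ∎
  where open ≡-Reasoning

-- g on positions 0 … n − 1 viewed as an n-periodic sequence; a step from p of length d that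
-- passes the end of the period lands on q.
record CyclicallyMonotone (s n : ℕ) (g : ℕ → ℕ) : Set where
  field
    forward  : ∀ p d → 1 ≤ d → d ≤ s → p + d < n → g (p + d) ≤ g p + 1
    wrapping : ∀ p q d → q < p → p < n → p + d ≡ q + n → d ≤ s → g q ≤ g p + 1

open CyclicallyMonotone

period-subst : ∀ {s m n g} → m ≡ n → CyclicallyMonotone s m g → CyclicallyMonotone s n g
period-subst refl mono = mono

PeriodicallyMonotone : ℕ → (n : ℕ) .{{_ : NonZero n}} → (ℕ → ℕ) → Set
PeriodicallyMonotone s n g =
  ∀ i d → 1 ≤ d → d ≤ s → g ((i ℤ.+ + d) %ℕ n) ≤ g (i %ℕ n) + 1

wrap⇒<distance : ∀ {p q d n} → p < n → p + d ≡ q + n → q < d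
wrap⇒<distance {p} {q} {d} {n} p<n eq = +-cancelˡ-≤ p (suc q) d (begin
  p + suc q   ≡⟨ +-suc p q ⟩
  suc p + q   ≤⟨ +-monoˡ-≤ q p<n ⟩
  n + q       ≡⟨ +-comm n q ⟩
  q + n       ≡⟨ eq ⟨
  p + d       ∎)
  where open ≤-Reasoning

periodic⇒cyclic : ∀ {s n g} .{{_ : NonZero n}} → PeriodicallyMonotone s n g → CyclicallyMonotone s n g
periodic⇒cyclic {s} {n} {g} mono = record { forward = fwd ; wrapping = wrap }
  where
  fwd : ∀ p d → 1 ≤ d → d ≤ s → p + d < n → g (p + d) ≤ g p + 1
  fwd p d 1≤d d≤s p+d<n =
    subst₂ (λ x y → g x ≤ g y + 1) (m<n⇒m%n≡m p+d<n) (m<n⇒m%n≡m (≤-<-trans (m≤m+n p d) p+d<n))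
           (mono (+ p) d 1≤d d≤s)
  wrap : ∀ p q d → q < p → p < n → p + d ≡ q + n → d ≤ s → g q ≤ g p + 1
  wrap p q d q<p p<n eq d≤s =
    subst₂ (λ x y → g x ≤ g y + 1) p+d%n≡q (m<n⇒m%n≡m p<n)
           (mono (+ p) d (<-≤-trans (s≤s z≤n) (wrap⇒<distance p<n eq)) d≤s)
    where
    p+d%n≡q : (p + d) % n ≡ q
    p+d%n≡q = trans (cong (_% n) eq) (trans ([m+n]%n≡m%n q n) (m<n⇒m%n≡m (<-trans q<p p<n)))

cyclic-step : ∀ {s n g} .{{_ : NonZero n}} → CyclicallyMonotone s n g →
  ∀ {r e} → r < n → e < n → e ≤ s → g ((r + e) % n) ≤ g r + 1
cyclic-step {n = n} {g} mono {r} {zero} r<n _ _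
  rewrite +-identityʳ r | m<n⇒m%n≡m r<n = m≤m+n (g r) 1
cyclic-step {n = n} {g} mono {r} {suc e} r<n e<n e≤s with r + suc e <? n
... | yes r+e<n rewrite m<n⇒m%n≡m r+e<n =
  forward mono r (suc e) (s≤s z≤n) e≤s r+e<n
... | no r+e≮n = subst (λ x → g x ≤ g r + 1) (sym r+e%n≡q)
  (wrapping mono r q (suc e) q<r r<n r+e≡q+n e≤s)
  where
  q = r + suc e ∸ n
  r+e≡q+n : r + suc e ≡ q + n
  r+e≡q+n = sym (m∸n+n≡m (≮⇒≥ r+e≮n))
  q<r : q < r
  q<r = +-cancelʳ-< n q r (subst (_< r + n) r+e≡q+n (+-monoʳ-< r e<n))
  r+e%n≡q : (r + suc e) % n ≡ q
  r+e%n≡q = trans (cong (_% n) r+e≡q+n) (trans ([m+n]%n≡m%n q n) (m<n⇒m%n≡m (<-trans q<r r<n)))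

cyclic⇒periodic : ∀ {s n g} .{{_ : NonZero n}} → CyclicallyMonotone s n g → PeriodicallyMonotone s n g
cyclic⇒periodic {s} {n} {g} mono i d _ d≤s = subst (λ x → g x ≤ g r + 1) (sym r+d%n)
  (cyclic-step mono (n%ℕd<d i n) (m%n<n d n) (≤-trans (m%n≤m d n) d≤s))
  where
  r = i %ℕ n
  r+d%n : (i ℤ.+ + d) %ℕ n ≡ (r + d % n) % n
  r+d%n = begin
    (i ℤ.+ + d) %ℕ n       ≡⟨ [i+d]%ℕn≡[i%ℕn+d]%n i d n ⟩
    (r + d) % n            ≡⟨ %-distribˡ-+ r d n ⟩
    (r % n + d % n) % n    ≡⟨ cong (λ x → (x + d % n) % n) (m<n⇒m%n≡m (n%ℕd<d i n)) ⟩
    (r + d % n) % n        ∎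
    where open ≡-Reasoning

cyclicallyMonotone-rotate : ∀ {s m n g h} → m < n → CyclicallyMonotone s (suc m) g →
  (∀ r → r < m → h r ≡ g (suc r)) → (∀ r → m ≤ r → r < n → h r ≡ g 0) →
  CyclicallyMonotone s n h
cyclicallyMonotone-rotate {s} {m} {n} {g} {h} m<n mono h-head h-tail =
  record { forward = fwd ; wrapping = wrap }
  where
  fwd : ∀ p d → 1 ≤ d → d ≤ s → p + d < n → h (p + d) ≤ h p + 1
  fwd p d 1≤d d≤s p+d<n with p + d <? m | p <? m
  ... | yes p+d<m | _ rewrite h-head (p + d) p+d<m | h-head p (≤-<-trans (m≤m+n p d) p+d<m) =
    forward mono (suc p) d 1≤d d≤s (s≤s p+d<m)
  ... | no p+d≮m | yes p<m rewrite h-tail (p + d) (≮⇒≥ p+d≮m) p+d<n | h-head p p<m =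
    wrapping mono (suc p) 0 (m ∸ p) (s≤s z≤n) (s≤s p<m) (cong suc (m+[n∸m]≡n (<⇒≤ p<m)))
             (≤-trans (m≤n+o⇒m∸n≤o m p (≮⇒≥ p+d≮m)) d≤s)
  ... | no p+d≮m | no p≮m rewrite h-tail (p + d) (≮⇒≥ p+d≮m) p+d<n
                              | h-tail p (≮⇒≥ p≮m) (≤-<-trans (m≤m+n p d) p+d<n) = m≤m+n (g 0) 1
  wrap : ∀ p q d → q < p → p < n → p + d ≡ q + n → d ≤ s → h q ≤ h p + 1
  wrap p q d q<p p<n p+d≡q+n d≤s with p <? m | q <? m
  ... | yes p<m | _ rewrite h-head p p<m | h-head q (<-trans q<p p<m) =
    wrapping mono (suc p) (suc q) d′ (s≤s q<p) (s≤s p<m) (cong suc (m+[n∸m]≡n p≤q+1+m))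
             (≤-trans d′≤d d≤s)
    where
    d′ = q + suc m ∸ p
    p≤q+1+m : p ≤ q + suc m
    p≤q+1+m = ≤-trans (<⇒≤ p<m) (≤-trans (n≤1+n m) (m≤n+m (suc m) q))
    d′≤d : d′ ≤ d
    d′≤d = subst (d′ ≤_) (trans (cong (_∸ p) (sym p+d≡q+n)) (m+n∸m≡n p d))
                 (∸-monoˡ-≤ p (+-monoʳ-≤ q m<n))
  ... | no p≮m | yes q<m rewrite h-tail p (≮⇒≥ p≮m) p<n | h-head q q<m =
    forward mono 0 (suc q) (s≤s z≤n) (≤-trans (wrap⇒<distance p<n p+d≡q+n) d≤s) (s≤s q<m)
  ... | no p≮m | no q≮m rewrite h-tail p (≮⇒≥ p≮m) p<n | h-tail q (≮⇒≥ q≮m) (<-trans q<p p<n) =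
    m≤m+n (g 0) 1

cyclicallyMonotone-drop : ∀ {s n g h} a → g 0 ≤ a → a ≤ n → (∀ p → p ≤ n → p < g p) →
  CyclicallyMonotone s (suc n) g →
  (∀ r → r < n → r < a → h r ≡ g (suc r)) → (∀ r → r < n → a ≤ r → suc (h r) ≡ g (suc r)) →
  CyclicallyMonotone s n h
cyclicallyMonotone-drop {s} {n} {g} {h} a g0≤a a≤n p<g mono h-below h-above =
  record { forward = fwd ; wrapping = wrap }
  where
  h≤g∘suc : ∀ r → r < n → h r ≤ g (suc r)
  h≤g∘suc r r<n with a ≤? r
  ... | yes a≤r = subst (h r ≤_) (h-above r r<n a≤r) (n≤1+n (h r))
  ... | no a≰r = ≤-reflexive (h-below r r<n (≰⇒> a≰r))

  fwd : ∀ p d → 1 ≤ d → d ≤ s → p + d < n → h (p + d) ≤ h p + 1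
  fwd p d 1≤d d≤s p+d<n with a ≤? p
  ... | yes a≤p = s≤s⁻¹ (subst₂ (λ x y → x ≤ y + 1)
                    (sym (h-above (p + d) p+d<n (≤-trans a≤p (m≤m+n p d)))) (sym (h-above p p<n a≤p))
                    (forward mono (suc p) d 1≤d d≤s (s≤s p+d<n)))
    where p<n = ≤-<-trans (m≤m+n p d) p+d<n
  ... | no a≰p = ≤-trans (h≤g∘suc (p + d) p+d<n)
                   (subst (λ y → g (suc (p + d)) ≤ y + 1) (sym (h-below p p<n (≰⇒> a≰p)))
                     (forward mono (suc p) d 1≤d d≤s (s≤s p+d<n)))
    where p<n = ≤-<-trans (m≤m+n p d) p+d<n

  wrap : ∀ p q d → q < p → p < n → p + d ≡ q + n → d ≤ s → h q ≤ h p + 1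
  wrap p q d q<p p<n p+d≡q+n d≤s = ≤-trans hq≤a+1 (+-monoˡ-≤ 1 a≤hp)
    where
    hq≤a+1 : h q ≤ a + 1
    hq≤a+1 = ≤-trans (h≤g∘suc q (<-trans q<p p<n)) (≤-trans
      (forward mono 0 (suc q) (s≤s z≤n) (≤-trans (wrap⇒<distance p<n p+d≡q+n) d≤s)
                 (s≤s (<-trans q<p p<n)))
      (+-monoˡ-≤ 1 g0≤a))
    n≤g[1+p] : n ≤ g (suc p)
    n≤g[1+p] with suc p <? n
    ... | no 1+p≮n = subst (λ x → n ≤ g x) (sym (≤-antisym p<n (≮⇒≥ 1+p≮n))) (<⇒≤ (p<g n ≤-refl))
    ... | yes 1+p<n = s≤s⁻¹ (begin
      suc n                    ≤⟨ p<g n ≤-refl ⟩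
      g n                      ≡⟨ cong g p+1+[n∸p+1]≡n ⟨
      g (suc p + (n ∸ suc p))  ≤⟨ forward mono (suc p) (n ∸ suc p) (m<n⇒0<n∸m 1+p<n) n∸[1+p]≤s
                                    (s≤s (≤-reflexive p+1+[n∸p+1]≡n)) ⟩
      g (suc p) + 1            ≡⟨ +-comm (g (suc p)) 1 ⟩
      suc (g (suc p))          ∎)
      where
      open ≤-Reasoning
      p+1+[n∸p+1]≡n = m+[n∸m]≡n (<⇒≤ 1+p<n)
      n∸[1+p]≤s : n ∸ suc p ≤ s
      n∸[1+p]≤s = ≤-trans (∸-monoʳ-≤ n (n≤1+n p))
                    (≤-trans (m≤n+o⇒m∸n≤o n p (subst (n ≤_) (sym p+d≡q+n) (m≤n+m n q))) d≤s)
    a≤hp : a ≤ h p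
    a≤hp with a ≤? p
    ... | yes a≤p =
      ≤-trans a≤p (<⇒≤ (s≤s⁻¹ (subst (suc p <_) (sym (h-above p p<n a≤p)) (p<g (suc p) p<n))))
    ... | no a≰p = subst (a ≤_) (sym (h-below p p<n (≰⇒> a≰p))) (≤-trans a≤n n≤g[1+p])

Φ-< : ∀ f {i} → i < f 0 → Φ f i ≡ suc (f (suc i))
Φ-< f {i} i<f0 = cong (if_then suc (f (suc i)) else f (suc i)) (dec-true (i <? f 0) i<f0)

Φ-≥ : ∀ f {i} → f 0 ≤ i → Φ f i ≡ f (suc i)
Φ-≥ f {i} f0≤i = cong (if_then suc (f (suc i)) else f (suc i)) (dec-false (i <? f 0) (≤⇒≯ f0≤i))

HasLength⇒≡0 : ∀ {f ℓ} → HasLength f ℓ → ∀ {i} → ℓ ≤ i → f i ≡ 0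
HasLength⇒≡0 {f} len {i} ℓ≤i with f i in fi≡
... | zero  = refl
... | suc _ = contradiction (proj₁ (len i) (subst (0 <_) (sym fi≡) (s≤s z≤n))) (≤⇒≯ ℓ≤i)

<⊔⇒< : ∀ {i m n} → m ≤ i → i < m ⊔ n → i < n
<⊔⇒< {i} {m} {n} m≤i i<m⊔n with ≤-total m n
... | inj₁ m≤n = subst (i <_) (m≤n⇒m⊔n≡n m≤n) i<m⊔n
... | inj₂ n≤m = contradiction (subst (i <_) (m≥n⇒m⊔n≡m n≤m) i<m⊔n) (≤⇒≯ m≤i)

Φ-hasLength : ∀ {f ℓ} → HasLength f ℓ → HasLength (Φ f) (f 0 ⊔ pred ℓ)
Φ-hasLength {f} {ℓ} len i with i <? f 0
... | yes i<f0 rewrite Φ-< f i<f0 = (λ _ → <-≤-trans i<f0 (m≤m⊔n (f 0) (pred ℓ))) , (λ _ → s≤s z≤n)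
... | no i≮f0 rewrite Φ-≥ f (≮⇒≥ i≮f0) =
  (λ 0<f[1+i] → ≤-trans (pred-mono-< (proj₁ (len (suc i)) 0<f[1+i])) (m≤n⊔m (f 0) (pred ℓ))) ,
  (λ i<max → proj₂ (len (suc i)) (pred-cancel-< (<⊔⇒< (≮⇒≥ i≮f0) i<max)))

energyAt : (ℕ → ℕ) → ℕ → ℕ
energyAt f r = f r + r

energyAt-Φ-< : ∀ f {r} → r < f 0 → energyAt (Φ f) r ≡ energyAt f (suc r)
energyAt-Φ-< f {r} r<f0 rewrite Φ-< f r<f0 = sym (+-suc (f (suc r)) r)

energyAt-Φ-≥ : ∀ f {r} → f 0 ≤ r → suc (energyAt (Φ f) r) ≡ energyAt f (suc r)
energyAt-Φ-≥ f {r} f0≤r rewrite Φ-≥ f f0≤r = sym (+-suc (f (suc r)) r)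

energyAt-Φ-beyond : ∀ {f ℓ r} → HasLength f ℓ → ℓ ≤ suc r → r ≤ f 0 → f 0 ≤ suc r →
  energyAt (Φ f) r ≡ energyAt f 0
energyAt-Φ-beyond {f} {ℓ} {r} len ℓ≤1+r r≤f0 f0≤1+r with m≤n⇒m<n∨m≡n r≤f0
... | inj₁ r<f0 = begin
  Φ f r + r             ≡⟨ cong (_+ r) (Φ-< f r<f0) ⟩
  suc (f (suc r) + r)   ≡⟨ cong (λ x → suc (x + r)) (HasLength⇒≡0 len ℓ≤1+r) ⟩
  suc r                 ≡⟨ ≤-antisym r<f0 f0≤1+r ⟩
  f 0                   ≡⟨ +-identityʳ (f 0) ⟨
  f 0 + 0               ∎
  where open ≡-Reasoning
... | inj₂ r≡f0 = begin
  Φ f r + r             ≡⟨ cong (_+ r) (Φ-≥ f (≤-reflexive (sym r≡f0))) ⟩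
  f (suc r) + r         ≡⟨ cong (_+ r) (HasLength⇒≡0 len ℓ≤1+r) ⟩
  r                     ≡⟨ r≡f0 ⟩
  f 0                   ≡⟨ +-identityʳ (f 0) ⟨
  f 0 + 0               ∎
  where open ≡-Reasoning

second≤first : ∀ {s n f ℓ} → HasLength f ℓ → ℓ ≤ n → CyclicallyMonotone (suc s) n (energyAt f) →
  f 1 ≤ f 0
second≤first {f = f} len ℓ≤n mono with 0 <? f 1
... | no f1≯0 = ≤-trans (≮⇒≥ f1≯0) z≤n
... | yes 0<f1 = +-cancelʳ-≤ 1 (f 1) (f 0)
  (subst (λ x → f 1 + 1 ≤ x + 1) (+-identityʳ (f 0))
    (forward mono 0 1 ≤-refl (s≤s z≤n) (≤-trans (proj₁ (len 1) 0<f1) ℓ≤n)))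

Φ-rotate : ∀ {s f ℓ m n} → HasLength f ℓ → ℓ ≤ suc m → m ≤ f 0 → f 0 ≤ suc m →
  m < n → n ≤ suc (f 0) →
  CyclicallyMonotone s (suc m) (energyAt f) → CyclicallyMonotone s n (energyAt (Φ f))
Φ-rotate {f = f} len ℓ≤1+m m≤f0 f0≤1+m m<n n≤1+f0 mono = cyclicallyMonotone-rotate m<n mono
  (λ r r<m → energyAt-Φ-< f (<-≤-trans r<m m≤f0))
  (λ r m≤r r<n → energyAt-Φ-beyond len (≤-trans ℓ≤1+m (s≤s m≤r)) (s≤s⁻¹ (≤-trans r<n n≤1+f0))
                   (≤-trans f0≤1+m (s≤s m≤r)))

Φ-drop : ∀ {s f n} → HasLength f (suc n) → f 0 ≤ n →
  CyclicallyMonotone s (suc n) (energyAt f) → CyclicallyMonotone s n (energyAt (Φ f))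
Φ-drop {f = f} len f0≤n mono = cyclicallyMonotone-drop (f 0) (≤-reflexive (+-identityʳ (f 0))) f0≤n
  (λ p p≤n → +-monoˡ-≤ p (proj₂ (len p) (s≤s p≤n))) mono
  (λ r _ r<f0 → energyAt-Φ-< f r<f0) (λ r _ f0≤r → energyAt-Φ-≥ f f0≤r)

f0≤1+L⇒period≡1+L : ∀ f {L} → f 0 ≤ suc L → period f L ≡ suc L
f0≤1+L⇒period≡1+L f f0≤1+L = cong suc (m≤n⇒m⊔n≡n (∸-monoˡ-≤ 1 f0≤1+L))

L<f0⇒period≡f0 : ∀ f {L} → L < f 0 → period f L ≡ f 0
L<f0⇒period≡f0 f L<f0 =
  trans (cong suc (m≥n⇒m⊔n≡m (∸-monoˡ-≤ 1 L<f0))) (m+[n∸m]≡n (<-≤-trans (s≤s z≤n) L<f0))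

Φ-cyclicallyMonotone-long : ∀ {s f L ℓ} → HasLength f (suc L) → f 1 ≤ f 0 → f 0 ≡ suc ℓ → L ≤ ℓ →
  CyclicallyMonotone s (suc ℓ) (energyAt f) → CyclicallyMonotone s (suc (f 1 ⊔ ℓ)) (energyAt (Φ f))
Φ-cyclicallyMonotone-long {f = f} {ℓ = ℓ} len f1≤f0 f0≡1+ℓ L≤ℓ =
  Φ-rotate len (s≤s L≤ℓ) ℓ≤f0 (≤-reflexive f0≡1+ℓ)
    (s≤s (m≤n⊔m (f 1) ℓ)) (s≤s (⊔-lub f1≤f0 ℓ≤f0))
  where
  ℓ≤f0 : ℓ ≤ f 0
  ℓ≤f0 = subst (ℓ ≤_) (sym f0≡1+ℓ) (n≤1+n ℓ)

Φ-cyclicallyMonotone-short : ∀ {s f ℓ} → HasLength f (suc (suc ℓ)) → f 1 ≤ f 0 → f 0 ≤ suc ℓ →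
  CyclicallyMonotone s (suc (suc ℓ)) (energyAt f) → CyclicallyMonotone s (suc (f 1 ⊔ ℓ)) (energyAt (Φ f))
Φ-cyclicallyMonotone-short {s} {f} {ℓ} len f1≤f0 f0≤1+ℓ mono with f 1 ≤? ℓ
... | yes f1≤ℓ = period-subst (cong suc (sym (m≤n⇒m⊔n≡n f1≤ℓ)))
                   (Φ-drop len f0≤1+ℓ mono)
... | no f1≰ℓ = Φ-rotate len ≤-refl (≤-trans ℓ<f1 f1≤f0) (m≤n⇒m≤1+n f0≤1+ℓ)
                  (s≤s (≤-trans ℓ<f1 (m≤m⊔n (f 1) ℓ)))
                  (s≤s (⊔-lub f1≤f0 (≤-trans (<⇒≤ ℓ<f1) f1≤f0))) mono
  where
  ℓ<f1 : ℓ < f 1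
  ℓ<f1 = ≰⇒> f1≰ℓ

Φ-cyclicallyMonotone : ∀ {s f L ℓ} → HasLength f (suc L) → f 1 ≤ f 0 → f 0 ⊔ L ≡ suc ℓ →
  CyclicallyMonotone s (period f L) (energyAt f) → CyclicallyMonotone s (suc (f 1 ⊔ ℓ)) (energyAt (Φ f))
Φ-cyclicallyMonotone {s} {f} {L} {ℓ} len f1≤f0 f0⊔L≡1+ℓ mono with L <? f 0
... | yes L<f0 = Φ-cyclicallyMonotone-long len f1≤f0 f0≡1+ℓ (s≤s⁻¹ (subst (suc L ≤_) f0≡1+ℓ L<f0))
                   (period-subst (trans (L<f0⇒period≡f0 f L<f0) f0≡1+ℓ) mono)
  where
  f0≡1+ℓ : f 0 ≡ suc ℓ
  f0≡1+ℓ = trans (sym (m≥n⇒m⊔n≡m (<⇒≤ L<f0))) f0⊔L≡1+ℓ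
... | no L≮f0 with trans (sym (m≤n⇒m⊔n≡n (≮⇒≥ L≮f0))) f0⊔L≡1+ℓ
...   | refl = Φ-cyclicallyMonotone-short len f1≤f0 (≮⇒≥ L≮f0)
                 (period-subst (f0≤1+L⇒period≡1+L f (m≤n⇒m≤1+n (≮⇒≥ L≮f0))) mono)

Φ-periodicallyMonotone : ∀ {s f L ℓ} → HasLength f (suc L) → f 1 ≤ f 0 → f 0 ⊔ L ≡ suc ℓ →
  PeriodicallyMonotone s (period f L) (energyAt f) → PeriodicallyMonotone s (period (Φ f) ℓ) (energyAt (Φ f))
Φ-periodicallyMonotone {s} {f} {L} {ℓ} len f1≤f0 f0⊔L≡1+ℓ mono = cyclic⇒periodic
  (period-subst (sym period-Φ)
    (Φ-cyclicallyMonotone len f1≤f0 f0⊔L≡1+ℓ (periodic⇒cyclic mono)))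
  where
  period-Φ : period (Φ f) ℓ ≡ suc (f 1 ⊔ ℓ)
  period-Φ = cong (λ x → suc ((x ∸ 1) ⊔ ℓ)) (Φ-< f (proj₂ (len 0) (s≤s z≤n)))

Φ-head-≤ : ∀ f → f 1 ≤ f 0 → Φ f 0 ≤ f 0 + 1
Φ-head-≤ f f1≤f0 with 0 <? f 0
... | yes f0>0 = subst (_≤ f 0 + 1) (sym (Φ-< f f0>0)) (subst (suc (f 1) ≤_) (+-comm 1 (f 0)) (s≤s f1≤f0))
... | no f0≯0 = subst (_≤ f 0 + 1) (sym (Φ-≥ f (≮⇒≥ f0≯0))) (≤-trans f1≤f0 (m≤m+n (f 0) 1))

mainTheorem4 : (s : ℕ) (f : ℕ → ℕ) → Monotone s f → Monotone s (Φ f)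
mainTheorem4 zero    f (ℓ , len) = f 0 ⊔ pred ℓ , Φ-hasLength len
mainTheorem4 (suc s) f (zero , len , _ , _) =
  f 0 ⊔ 0 , Φ-hasLength len , ≤-trans (Φ-head-≤ f f1≤f0) (+-monoˡ-≤ 1 (m≤m⊔n (f 0) 0)) ,
  λ _ f0⊔0≡1+ℓ → contradiction (trans (sym (trans (⊔-identityʳ (f 0)) f0≡0)) f0⊔0≡1+ℓ) 0≢1+n
  where
  f0≡0 : f 0 ≡ 0
  f0≡0 = HasLength⇒≡0 len z≤n
  f1≤f0 : f 1 ≤ f 0
  f1≤f0 = subst (_≤ f 0) (sym (HasLength⇒≡0 len z≤n)) z≤n
mainTheorem4 (suc s) f (suc L , len , _ , mono) =
  f 0 ⊔ L , Φ-hasLength len , ≤-trans (Φ-head-≤ f f1≤f0) (+-monoˡ-≤ 1 (m≤m⊔n (f 0) L)) ,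
  λ ℓ f0⊔L≡1+ℓ → Φ-periodicallyMonotone len f1≤f0 f0⊔L≡1+ℓ (mono L refl)
  where
  f1≤f0 : f 1 ≤ f 0
  f1≤f0 = second≤first len (s≤s (m≤n⊔m (f 0 ∸ 1) L)) (periodic⇒cyclic (mono L refl))
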